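{- For every integer $a\geq 4$, the set of (isomorphism classes of) finite, simple, connected graphs $G$ with $\mathrm{res}(G)=a$ is finite.
   Context: $d(u,v)$ is the length of a shortest $u$-$v$ path. A vertex $w$ resolves a pair $\{x,y\}$ if $d(w,x)\neq d(w,y)$. A set $S\subseteq V(G)$ is a resolving set if every pair of vertices is resolved by some vertex of $S$. The resolving number $\mathrm{res}(G)$ is the minimum $k$ such that every $k$-subset of $V(G)$ is a resolving set. -}

module Defs where

open import Data.Nat using (ℕ; zero; suc; _≤_; _<_)
open import Data.Fin using (Fin)
open import Data.Fin.Subset using (Subset; _∈_; ∣_∣)
open import Data.Bool using (Bool; true; false)
open import Data.Product using (Σ; ∃; _×_; _,_)
open import Relation.Binary.PropositionalEquality using (_≡_; _≢_)
open import Relation.Nullary using (¬_)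
open import Function.Bundles using (_↔_; Inverse)

record Graph : Set where
  field
    n      : ℕ
    adj    : Fin n → Fin n → Bool
    sym    : ∀ u v → adj u v ≡ adj v u
    irrefl : ∀ u → adj u u ≡ false
open Graph public

V : Graph → Set
V G = Fin (n G)

data Walk (G : Graph) : V G → V G → ℕ → Set where
  here : ∀ {u} → Walk G u u zero
  step : ∀ {u w v k} → adj G u w ≡ true → Walk G w v k → Walk G u v (suc k)

Connected : Graph → Set
Connected G = ∀ (u v : V G) → ∃ λ k → Walk G u v k

IsDist : (G : Graph) → V G → V G → ℕ → Set
IsDist G u v k = Walk G u v k × (∀ j → Walk G u v j → k ≤ j)

Resolves : (G : Graph) → V G → V G → V G → Set
Resolves G w x y = ∀ k l → IsDist G w x k → IsDist G w y l → k ≢ l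

IsResolvingSet : (G : Graph) → Subset (n G) → Set
IsResolvingSet G S =
  ∀ (x y : V G) → x ≢ y → ∃ λ w → w ∈ S × Resolves G w x y

AllKSubsetsResolve : Graph → ℕ → Set
AllKSubsetsResolve G k = ∀ (S : Subset (n G)) → ∣ S ∣ ≡ k → IsResolvingSet G S

ResNumberIs : Graph → ℕ → Set
ResNumberIs G a = AllKSubsetsResolve G a × (∀ k → k < a → ¬ AllKSubsetsResolve G k)

_≅_ : Graph → Graph → Set
G ≅ H = Σ (V G ↔ V H) λ f →
  ∀ u v → adj H (Inverse.to f u) (Inverse.to f v) ≡ adj G u v

module Submission where

-- Write a = m + 1 with m ≥ 3, and let E(x,y) be the set of vertices that are
-- equidistant from x and y.  If every (m+1)-subset of V(G) resolves, then
-- |E(x,y)| ≤ m whenever x ≠ y, since an (m+1)-subset of E(x,y) would not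
-- resolve {x,y}.  Two cases:
--   * some vertex z has three distinct neighbours p, q, r.  For every w the
--     distances d(w,p), d(w,q), d(w,r) lie in {d(w,z)-1, d(w,z), d(w,z)+1},
--     so two of d(w,z), d(w,p), d(w,q), d(w,r) coincide and w lies in one of
--     the six sets E(s,t) with s ≠ t in {z,p,q,r}; hence |V(G)| ≤ 6m.
--   * G has maximum degree at most 2.  A geodesic argument shows that no pair
--     x ≠ y has three equidistant vertices, so every m-subset already
--     resolves, contradicting the minimality of a.
-- So |V(G)| ≤ 6m, and the theorem follows from a list containing every graph
-- on at most N vertices up to isomorphism (all adjacency matrices).

open import Defs
open import Data.Nat using (ℕ; zero; suc; _+_; _*_; _∸_; _≤_; _<_; z≤n; s≤s; _≟_; _≤?_)
open import Data.Nat.Properties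
open import Data.Fin using (Fin; zero; suc) renaming (_≟_ to _≟ᶠ_)
open import Data.Fin.Properties using (any?)
open import Data.Fin.Subset using (Subset; _∈_; _∉_; _⊆_; ∣_∣; _∪_; ⊤; ⋃; inside; outside)
open import Data.Fin.Subset.Properties
  using (_∈?_; p⊆q⇒∣p∣≤∣q∣; ∣⊤∣≡n; ∣⊥∣≡0; ∣p∣≤∣x∷p∣; x∈p∪q⁺)
open import Data.Vec using ([]; _∷_; tabulate)
import Data.Vec.Base as Vec
open import Data.Vec.Properties using (lookup∘tabulate; []=⇒lookup; lookup⇒[]=)
import Data.Vec.Functional as Vector
open import Data.Bool using (Bool; true; false; not; _∧_) renaming (_≟_ to _≟ᵇ_)
open import Data.Bool.Properties using (∧-comm; ∧-idem)
open import Data.List using (List; map; length; concat; applyUpTo; cartesianProductWith)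
  renaming ([] to []ˡ; _∷_ to _∷ˡ_)
open import Data.List.Relation.Unary.Any using (Any; here; there)
import Data.List.Relation.Unary.Any as Any
import Data.List.Relation.Unary.Any.Properties as Any
open import Data.List.Relation.Unary.All using (All) renaming ([] to []ᵃ; _∷_ to _∷ᵃ_)
import Data.List.Relation.Unary.All as All
import Data.List.Relation.Unary.All.Properties as All
open import Data.Product using (Σ; ∃; _×_; _,_; proj₁; proj₂; uncurry)
open import Data.Sum using (_⊎_; inj₁; inj₂; [_,_]′)
open import Data.Empty using (⊥; ⊥-elim)
open import Relation.Nullary using (Dec; yes; no; does; ¬?)
open import Relation.Nullary.Decidable using (_×-dec_; dec-true; decidable-stable)
open import Relation.Binary.Definitions using (tri<; tri≈; tri>)
open import Function.Properties.Inverse using (↔-refl)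
open import Relation.Binary.PropositionalEquality
  using (_≡_; _≢_; refl; cong; cong₂; subst; trans; module ≡-Reasoning) renaming (sym to ≡-sym)

minimal : {P : ℕ → Set} → (∀ i → Dec (P i)) → ∀ k → P k →
          Σ ℕ λ j → P j × (∀ i → P i → j ≤ i)
minimal P? zero p0 = zero , p0 , λ _ _ → z≤n
minimal P? (suc k) pk with P? zero
... | yes p0 = zero , p0 , λ _ _ → z≤n
... | no ¬p0 with minimal (λ i → P? (suc i)) k pk
...   | j , pj , least = suc j , pj , λ where
          zero p    → ⊥-elim (¬p0 p)
          (suc i) p → s≤s (least i p)

module Distance (G : Graph) (conn : Connected G) where

  adj-sym : ∀ {u v} → adj G u v ≡ true → adj G v u ≡ true
  adj-sym {u} {v} e = trans (sym G v u) e

  adj⇒≢ : ∀ {u v} → adj G u v ≡ true → u ≢ v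
  adj⇒≢ {u} e refl with trans (≡-sym e) (irrefl G u)
  ... | ()

  snoc : ∀ {u v w k} → Walk G u v k → adj G v w ≡ true → Walk G u w (suc k)
  snoc here       e′ = step e′ here
  snoc (step e p) e′ = step e (snoc p e′)

  reverse : ∀ {u v k} → Walk G u v k → Walk G v u k
  reverse here       = here
  reverse (step e p) = snoc (reverse p) (adj-sym e)

  _++ʷ_ : ∀ {u v w k l} → Walk G u v k → Walk G v w l → Walk G u w (k + l)
  here     ++ʷ q = q
  step e p ++ʷ q = step e (p ++ʷ q)

  walk? : ∀ k u v → Dec (Walk G u v k)
  walk? zero u v with u ≟ᶠ v
  ... | yes refl = yes here
  ... | no u≢v   = no λ { here → u≢v refl }
  walk? (suc k) u v with any? (λ w → (adj G u w ≟ᵇ true) ×-dec walk? k w v)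
  ... | yes (w , e , p) = yes (step e p)
  ... | no ¬step        = no λ { (step e p) → ¬step (_ , e , p) }

  shortest : ∀ u v → Σ ℕ (IsDist G u v)
  shortest u v = minimal (λ k → walk? k u v) (proj₁ (conn u v)) (proj₂ (conn u v))

  d : V G → V G → ℕ
  d u v = proj₁ (shortest u v)

  geodesic : ∀ u v → Walk G u v (d u v)
  geodesic u v = proj₁ (proj₂ (shortest u v))

  d-least : ∀ {u v k} → Walk G u v k → d u v ≤ k
  d-least {u} {v} p = proj₂ (proj₂ (shortest u v)) _ p

  IsDist⇒≡d : ∀ {u v k} → IsDist G u v k → k ≡ d u v
  IsDist⇒≡d {u} {v} (p , least) = ≤-antisym (least _ (geodesic u v)) (d-least p)

  d-isDist : ∀ u v → IsDist G u v (d u v)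
  d-isDist u v = geodesic u v , λ _ → d-least

  d≡0⇒≡ : ∀ {u v} → d u v ≡ 0 → u ≡ v
  d≡0⇒≡ {u} {v} e = length0 (subst (Walk G u v) e (geodesic u v))
    where
    length0 : ∀ {u v} → Walk G u v 0 → u ≡ v
    length0 here = refl

  d-sym : ∀ u v → d u v ≡ d v u
  d-sym u v = ≤-antisym (d-least (reverse (geodesic v u))) (d-least (reverse (geodesic u v)))

  d-triangle : ∀ u v w → d u w ≤ d u v + d v w
  d-triangle u v w = d-least (geodesic u v ++ʷ geodesic v w)

  d-adj : ∀ {u v} → adj G u v ≡ true → d u v ≤ 1
  d-adj e = d-least (step e here)

  d-edge : ∀ w {u v} → adj G u v ≡ true → d w v ≤ suc (d w u)
  d-edge w {u} {v} e = begin
    d w v         ≤⟨ d-triangle w u v ⟩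
    d w u + d u v ≤⟨ +-monoʳ-≤ (d w u) (d-adj e) ⟩
    d w u + 1     ≡⟨ +-comm (d w u) 1 ⟩
    suc (d w u)   ∎
    where open ≤-Reasoning

  d-firstStep : ∀ {u v k} → d u v ≡ suc k → ∃ λ p → adj G u p ≡ true × d p v ≡ k
  d-firstStep {u} {v} {k} duv with subst (Walk G u v) duv (geodesic u v)
  ... | step {w = p} e walk = p , e , ≤-antisym (d-least walk) (≤-pred lower)
    where
    open ≤-Reasoning
    lower : suc k ≤ suc (d p v)
    lower = begin
      suc k         ≡⟨ ≡-sym duv ⟩
      d u v         ≤⟨ d-triangle u p v ⟩
      d u p + d p v ≤⟨ +-monoˡ-≤ (d p v) (d-adj e) ⟩
      suc (d p v)   ∎

  d-lastStep : ∀ {u v k} → d u v ≡ suc k → ∃ λ p → adj G v p ≡ true × d u p ≡ k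
  d-lastStep {u} {v} duv with d-firstStep (trans (d-sym v u) duv)
  ... | p , e , dpu = p , e , trans (d-sym u p) dpu

  resolves⇒≢ : ∀ {w x y} → Resolves G w x y → d w x ≢ d w y
  resolves⇒≢ {w} {x} {y} r = r _ _ (d-isDist w x) (d-isDist w y)

  ≢⇒resolves : ∀ {w x y} → d w x ≢ d w y → Resolves G w x y
  ≢⇒resolves ne k l dk dl k≡l =
    ne (trans (≡-sym (IsDist⇒≡d dk)) (trans k≡l (IsDist⇒≡d dl)))

select : ∀ {k} {P : Fin k → Set} → (∀ i → Dec (P i)) → Subset k
select P? = tabulate (λ i → does (P? i))

select⁺ : ∀ {k} {P : Fin k → Set} (P? : ∀ i → Dec (P i)) {i} → P i → i ∈ select P?
select⁺ P? {i} p = lookup⇒[]= i _ (trans (lookup∘tabulate _ i) (dec-true (P? i) p))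

select⁻ : ∀ {k} {P : Fin k → Set} (P? : ∀ i → Dec (P i)) {i} → i ∈ select P? → P i
select⁻ P? {i} i∈ with P? i | trans (≡-sym (lookup∘tabulate _ i)) ([]=⇒lookup i∈)
... | yes p | _ = p
... | no _  | ()

∣p∪q∣≤∣p∣+∣q∣ : ∀ {k} (p q : Subset k) → ∣ p ∪ q ∣ ≤ ∣ p ∣ + ∣ q ∣
∣p∪q∣≤∣p∣+∣q∣ []          []          = z≤n
∣p∪q∣≤∣p∣+∣q∣ (true ∷ p)  (t ∷ q)     =
  s≤s (≤-trans (∣p∪q∣≤∣p∣+∣q∣ p q) (+-monoʳ-≤ ∣ p ∣ (∣p∣≤∣x∷p∣ t q)))
∣p∪q∣≤∣p∣+∣q∣ (false ∷ p) (true ∷ q)  =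
  ≤-trans (s≤s (∣p∪q∣≤∣p∣+∣q∣ p q)) (≤-reflexive (≡-sym (+-suc ∣ p ∣ ∣ q ∣)))
∣p∪q∣≤∣p∣+∣q∣ (false ∷ p) (false ∷ q) = ∣p∪q∣≤∣p∣+∣q∣ p q

∈⋃⁺ : ∀ {k} {i : Fin k} {ps : List (Subset k)} → Any (i ∈_) ps → i ∈ ⋃ ps
∈⋃⁺ (here i∈p)   = x∈p∪q⁺ (inj₁ i∈p)
∈⋃⁺ (there i∈ps) = x∈p∪q⁺ (inj₂ (∈⋃⁺ i∈ps))

∣⋃∣≤ : ∀ {k m} (ps : List (Subset k)) → All (λ p → ∣ p ∣ ≤ m) ps → ∣ ⋃ ps ∣ ≤ length ps * m
∣⋃∣≤ {k} []ˡ        []ᵃ         = ≤-reflexive (∣⊥∣≡0 k)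
∣⋃∣≤     (p ∷ˡ ps) (p≤ ∷ᵃ ps≤) =
  ≤-trans (∣p∪q∣≤∣p∣+∣q∣ p (⋃ ps)) (+-mono-≤ p≤ (∣⋃∣≤ ps ps≤))

⊆-drop : ∀ {k t} {p q : Subset k} → p ⊆ q → (outside ∷ p) ⊆ (t ∷ q)
⊆-drop p⊆q (Vec.there i∈p) = Vec.there (p⊆q i∈p)

⊆-keep : ∀ {k} {p q : Subset k} → p ⊆ q → (inside ∷ p) ⊆ (inside ∷ q)
⊆-keep p⊆q Vec.here          = Vec.here
⊆-keep p⊆q (Vec.there i∈p) = Vec.there (p⊆q i∈p)

subsetOfSize : ∀ {k} (T : Subset k) j → j ≤ ∣ T ∣ → ∃ λ S → S ⊆ T × ∣ S ∣ ≡ j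
subsetOfSize []           zero    _       = [] , (λ i∈ → i∈) , refl
subsetOfSize (true ∷ T)   zero    _       with subsetOfSize T zero z≤n
... | S , S⊆T , ∣S∣ = outside ∷ S , ⊆-drop S⊆T , ∣S∣
subsetOfSize (true ∷ T)   (suc j) (s≤s j≤) with subsetOfSize T j j≤
... | S , S⊆T , ∣S∣ = inside ∷ S , ⊆-keep S⊆T , cong suc ∣S∣
subsetOfSize (false ∷ T)  j       j≤      with subsetOfSize T j j≤
... | S , S⊆T , ∣S∣ = outside ∷ S , ⊆-drop S⊆T , ∣S∣

pick : ∀ {k} (T : Subset k) j → suc j ≤ ∣ T ∣ →
       ∃ λ i → i ∈ T × ∃ λ T′ → T′ ⊆ T × i ∉ T′ × j ≤ ∣ T′ ∣
pick (true ∷ T)  j (s≤s j≤) = zero , Vec.here , outside ∷ T , ⊆-drop (λ i∈ → i∈) , (λ ()) , j≤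
pick (false ∷ T) j j≤ with pick T j j≤
... | i , i∈T , T′ , T′⊆T , i∉T′ , j≤′ =
  suc i , Vec.there i∈T , outside ∷ T′ , ⊆-drop T′⊆T , (λ { (Vec.there i∈) → i∉T′ i∈ }) , j≤′

threeMembers : ∀ {k} (T : Subset k) → 3 ≤ ∣ T ∣ → ∃ λ a → ∃ λ b → ∃ λ c →
  (a ∈ T × b ∈ T × c ∈ T) × (a ≢ b × a ≢ c × b ≢ c)
threeMembers T 3≤ with pick T 2 3≤
... | a , a∈ , T₁ , T₁⊆ , a∉ , 2≤ with pick T₁ 1 2≤
... | b , b∈ , T₂ , T₂⊆ , b∉ , 1≤ with pick T₂ 0 1≤
... | c , c∈ , _  , _   , _   , _  =
  a , b , c , (a∈ , T₁⊆ b∈ , T₁⊆ (T₂⊆ c∈)) ,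
  ((λ { refl → a∉ b∈ }) , (λ { refl → a∉ (T₂⊆ c∈) }) , (λ { refl → b∉ c∈ }))

module Equidistant (G : Graph) (conn : Connected G) where
  open Distance G conn

  equidistant : V G → V G → Subset (n G)
  equidistant x y = select (λ w → d w x ≟ d w y)

  ∈equidistant⁺ : ∀ {x y w} → d w x ≡ d w y → w ∈ equidistant x y
  ∈equidistant⁺ {x} {y} = select⁺ (λ w → d w x ≟ d w y)

  ∈equidistant⁻ : ∀ {x y w} → w ∈ equidistant x y → d w x ≡ d w y
  ∈equidistant⁻ {x} {y} = select⁻ (λ w → d w x ≟ d w y)

  equidistant-bound : ∀ {m} → AllKSubsetsResolve G (suc m) →
                      ∀ {x y} → x ≢ y → ∣ equidistant x y ∣ ≤ m
  equidistant-bound {m} allRes {x} {y} x≢y with ∣ equidistant x y ∣ ≤? m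
  ... | yes small = small
  ... | no large with subsetOfSize (equidistant x y) (suc m) (≰⇒> large)
  ...   | S , S⊆E , ∣S∣ with allRes S ∣S∣ x y x≢y
  ...     | w , w∈S , w-resolves = ⊥-elim (resolves⇒≢ w-resolves (∈equidistant⁻ (S⊆E w∈S)))

data Near : ℕ → ℕ → Set where
  same  : ∀ {D} → Near D D
  above : ∀ {D} → Near D (suc D)
  below : ∀ {a} → Near (suc a) a

near : ∀ {D a} → a ≤ suc D → D ≤ suc a → Near D a
near {D} {a} a≤ D≤ with <-cmp a D
... | tri≈ _ refl _ = same
... | tri< a<D _ _ with ≤-antisym a<D D≤
...   | refl = below
near {D} {a} a≤ D≤ | tri> _ _ D<a with ≤-antisym a≤ D<a
...   | refl = above

pairs : {A : Set} → A → A → A → A → List (A × A)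
pairs z p q r = (z , p) ∷ˡ (z , q) ∷ˡ (z , r) ∷ˡ (p , q) ∷ˡ (p , r) ∷ˡ (q , r) ∷ˡ []ˡ

near-pigeonhole : ∀ {D a b c} → Near D a → Near D b → Near D c →
                  Any (uncurry _≡_) (pairs D a b c)
near-pigeonhole same  _     _     = here refl
near-pigeonhole _     same  _     = there (here refl)
near-pigeonhole _     _     same  = there (there (here refl))
near-pigeonhole above above _     = there (there (there (here refl)))
near-pigeonhole below below _     = there (there (there (here refl)))
near-pigeonhole above below above = there (there (there (there (here refl))))
near-pigeonhole below above below = there (there (there (there (here refl))))
near-pigeonhole above below below = there (there (there (there (there (here refl)))))
near-pigeonhole below above above = there (there (there (there (there (here refl)))))

module DegreeThree (G : Graph) (conn : Connected G) where
  open Distance G conn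
  open Equidistant G conn

  d-near : ∀ w {z u} → adj G z u ≡ true → Near (d w z) (d w u)
  d-near w e = near (d-edge w e) (d-edge w (adj-sym e))

  covered : ∀ {z p q r} → adj G z p ≡ true → adj G z q ≡ true → adj G z r ≡ true →
            ∀ w → w ∈ ⋃ (map (uncurry equidistant) (pairs z p q r))
  covered ep eq er w =
    ∈⋃⁺ (Any.map⁺ (Any.map (λ {st} → ∈equidistant⁺ {proj₁ st} {proj₂ st})
      (Any.map⁻ (near-pigeonhole (d-near w ep) (d-near w eq) (d-near w er)))))

  degree-three-bound : ∀ {m} → AllKSubsetsResolve G (suc m) →
    ∀ {z p q r} → adj G z p ≡ true → adj G z q ≡ true → adj G z r ≡ true →
    p ≢ q → p ≢ r → q ≢ r → n G ≤ 6 * m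
  degree-three-bound {m} allRes {z} {p} {q} {r} ep eq er p≢q p≢r q≢r = begin
    n G         ≡⟨ ≡-sym (∣⊤∣≡n (n G)) ⟩
    ∣ ⊤ {n G} ∣ ≤⟨ p⊆q⇒∣p∣≤∣q∣ {p = ⊤} (λ {w} _ → covered ep eq er w) ⟩
    ∣ ⋃ sets ∣  ≤⟨ ∣⋃∣≤ sets (All.map⁺ (All.map (equidistant-bound allRes) distinct)) ⟩
    6 * m       ∎
    where
    open ≤-Reasoning
    sets : List (Subset (n G))
    sets = map (uncurry equidistant) (pairs z p q r)
    distinct : All (uncurry _≢_) (pairs z p q r)
    distinct = adj⇒≢ ep ∷ᵃ adj⇒≢ eq ∷ᵃ adj⇒≢ er ∷ᵃ p≢q ∷ᵃ p≢r ∷ᵃ q≢r ∷ᵃ []ᵃ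

MaxDegreeTwo : Graph → Set
MaxDegreeTwo G = ∀ z p q r → adj G z p ≡ true → adj G z q ≡ true → adj G z r ≡ true →
  p ≡ q ⊎ p ≡ r ⊎ q ≡ r

module DegreeTwo (G : Graph) (conn : Connected G) (deg2 : MaxDegreeTwo G) where
  open Distance G conn
  open Equidistant G conn

  module Levels (x y : V G) (x≢y : x ≢ y) where

    ℓ ρ : V G → ℕ
    ℓ = d x
    ρ = d y

    Tied : V G → Set
    Tied w = ℓ w ≡ ρ w

    -- w is reached from x by a geodesic passing through u.
    Beyond : V G → V G → Set
    Beyond u w = ℓ w ≡ ℓ u + d u w

    level-clash : ∀ (f : V G → ℕ) {s a b} → a ≡ b → f a ≡ suc (suc s) → f b ≡ s → ⊥
    level-clash f refl fa fb = m≢1+n+m _ (trans (≡-sym fb) fa)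

    equidistant⇒tied : ∀ {w} → w ∈ equidistant x y → Tied w
    equidistant⇒tied {w} w∈ = trans (d-sym x w) (trans (∈equidistant⁻ w∈) (d-sym w y))

    -- No edge joins a tied vertex to a tied vertex one level further from x:
    -- the neighbours of v towards x and towards y differ from v′, so by degree
    -- two they coincide, which gives a tied edge one level lower.
    no-rising-tied-edge : ∀ s {v v′} → ℓ v ≡ s → adj G v v′ ≡ true → ℓ v′ ≡ suc s →
                          Tied v → Tied v′ → ⊥
    no-rising-tied-edge zero ℓv _ _ tv _ =
      x≢y (trans (d≡0⇒≡ ℓv) (≡-sym (d≡0⇒≡ (trans (≡-sym tv) ℓv))))
    no-rising-tied-edge (suc s) {v} {v′} ℓv e ℓv′ tv tv′
      with d-lastStep ℓv | d-lastStep (trans (≡-sym tv) ℓv)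
    ... | px , epx , ℓpx | py , epy , ρpy with deg2 v v′ px py e epx epy
    ... | inj₁ v′≡px        = level-clash ℓ v′≡px ℓv′ ℓpx
    ... | inj₂ (inj₁ v′≡py) = level-clash ρ v′≡py (trans (≡-sym tv′) ℓv′) ρpy
    ... | inj₂ (inj₂ refl)  =
      no-rising-tied-edge s ℓpx (adj-sym epx) ℓv (trans ℓpx (≡-sym ρpy)) tv

    tied-below : ∀ {w p} → Tied w → adj G p w ≡ true → suc (ℓ p) ≡ ℓ w → ℓ p < ρ p
    tied-below {w} {p} tw e ℓw = ≤∧≢⇒< ℓp≤ρp ℓp≢ρp
      where
      ℓp≤ρp : ℓ p ≤ ρ p
      ℓp≤ρp = ≤-pred (subst (_≤ suc (ρ p)) (trans (≡-sym tw) (≡-sym ℓw)) (d-edge y e))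
      ℓp≢ρp : ℓ p ≢ ρ p
      ℓp≢ρp tp = no-rising-tied-edge (ℓ p) refl e (≡-sym ℓw) tp tw

    closer-on-geodesic : ∀ {v a} → ℓ a < ρ a → Beyond v a → ℓ v < ρ v
    closer-on-geodesic {v} {a} ℓa<ρa ba = +-cancelʳ-< (d v a) (ℓ v) (ρ v) (begin-strict
      ℓ v + d v a ≡⟨ ≡-sym ba ⟩
      ℓ a         <⟨ ℓa<ρa ⟩
      ρ a         ≤⟨ d-triangle y v a ⟩
      ρ v + d v a ∎)
      where open ≤-Reasoning

    -- Two distinct tied vertices cannot lie one beyond the other: the
    -- neighbour p of w₂ on a geodesic from w₁ is closer to x than to y
    -- (tied-below), and this propagates back from p to w₁.
    tied-beyond-tied : ∀ {w₁ w₂} → Tied w₁ → Tied w₂ → Beyond w₁ w₂ → w₁ ≡ w₂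
    tied-beyond-tied {w₁} {w₂} tw₁ tw₂ b with d w₁ w₂ in d₁₂
    ... | zero  = d≡0⇒≡ d₁₂
    ... | suc j with d-lastStep d₁₂
    ...   | p , e , d₁p = ⊥-elim (<-irrefl tw₁ (closer-on-geodesic ℓp<ρp beyond))
      where
      open ≤-Reasoning
      ℓp≡ : ℓ p ≡ ℓ w₁ + j
      ℓp≡ = ≤-antisym
        (subst (λ t → ℓ p ≤ ℓ w₁ + t) d₁p (d-triangle x w₁ p))
        (≤-pred (begin
          suc (ℓ w₁ + j) ≡⟨ ≡-sym (+-suc (ℓ w₁) j) ⟩
          ℓ w₁ + suc j   ≡⟨ ≡-sym b ⟩
          ℓ w₂           ≤⟨ d-edge x (adj-sym e) ⟩
          suc (ℓ p)      ∎))
      ℓp<ρp : ℓ p < ρ p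
      ℓp<ρp = tied-below tw₂ (adj-sym e)
        (trans (cong suc ℓp≡) (trans (≡-sym (+-suc (ℓ w₁) j)) (≡-sym b)))
      beyond : Beyond w₁ p
      beyond = trans ℓp≡ (cong (ℓ w₁ +_) (≡-sym d₁p))

    step-beyond : ∀ {u p w j} → Beyond u w → adj G u p ≡ true →
                  d p w ≡ j → d u w ≡ suc j → ℓ p ≡ suc (ℓ u) × Beyond p w
    step-beyond {u} {p} {w} {j} b e dpw duw =
      ℓp≡ , trans ℓw≡ (cong₂ _+_ (≡-sym ℓp≡) (≡-sym dpw))
      where
      open ≤-Reasoning
      ℓw≡ : ℓ w ≡ suc (ℓ u) + j
      ℓw≡ = trans b (trans (cong (ℓ u +_) duw) (+-suc (ℓ u) j))
      ℓp≡ : ℓ p ≡ suc (ℓ u)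
      ℓp≡ = ≤-antisym (d-edge x e) (+-cancelʳ-≤ j (suc (ℓ u)) (ℓ p) (begin
        suc (ℓ u) + j ≡⟨ ≡-sym ℓw≡ ⟩
        ℓ w           ≤⟨ d-triangle x p w ⟩
        ℓ p + d p w   ≡⟨ cong (ℓ p +_) dpw ⟩
        ℓ p + j       ∎))

    -- Beyond a vertex u ≠ x the geodesics leaving u are nested: by degree two
    -- only one edge at u leads away from x.  So if d(u,w₂) = d(u,w₁) + j
    -- then d(w₁,w₂) = j.
    nested : ∀ k {j u w₁ w₂ s} → ℓ u ≡ suc s → Beyond u w₁ → Beyond u w₂ →
             d u w₁ ≡ k → d u w₂ ≡ k + j → d w₁ w₂ ≡ j
    nested zero _ _ _ du₁ du₂ with d≡0⇒≡ du₁
    ... | refl = du₂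
    nested (suc k) {u = u} ℓu b₁ b₂ du₁ du₂
      with d-firstStep du₁ | d-firstStep du₂ | d-lastStep ℓu
    ... | p₁ , e₁ , dp₁ | p₂ , e₂ , dp₂ | r , er , ℓr
      with step-beyond b₁ e₁ dp₁ du₁ | step-beyond b₂ e₂ dp₂ du₂ | deg2 u p₁ p₂ r e₁ e₂ er
    ... | ℓp₁ , b₁′ | _   , b₂′ | inj₁ refl        = nested k ℓp₁ b₁′ b₂′ dp₁ dp₂
    ... | ℓp₁ , _   | _   , _   | inj₂ (inj₁ p₁≡r) =
      ⊥-elim (level-clash ℓ p₁≡r (trans ℓp₁ (cong suc ℓu)) ℓr)
    ... | _   , _   | ℓp₂ , _   | inj₂ (inj₂ p₂≡r) =
      ⊥-elim (level-clash ℓ p₂≡r (trans ℓp₂ (cong suc ℓu)) ℓr)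

    beyond-nested : ∀ {u w₁ w₂ s} → ℓ u ≡ suc s → Beyond u w₁ → Beyond u w₂ →
                    d u w₁ ≤ d u w₂ → Beyond w₁ w₂
    beyond-nested {u} {w₁} {w₂} ℓu b₁ b₂ le = begin
      ℓ w₂               ≡⟨ b₂ ⟩
      ℓ u + d u w₂       ≡⟨ cong (ℓ u +_) split ⟩
      ℓ u + (d u w₁ + j) ≡⟨ ≡-sym (+-assoc (ℓ u) (d u w₁) j) ⟩
      ℓ u + d u w₁ + j   ≡⟨ cong₂ _+_ (≡-sym b₁) (≡-sym (nested _ ℓu b₁ b₂ refl split)) ⟩
      ℓ w₁ + d w₁ w₂     ∎
      where
      open ≡-Reasoning
      j = d u w₂ ∸ d u w₁
      split : d u w₂ ≡ d u w₁ + j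
      split = ≡-sym (m+[n∸m]≡n le)

    tied-beyond-same : ∀ {u w₁ w₂ s} → ℓ u ≡ suc s → Beyond u w₁ → Beyond u w₂ →
                       Tied w₁ → Tied w₂ → w₁ ≡ w₂
    tied-beyond-same {u} {w₁} {w₂} ℓu b₁ b₂ tw₁ tw₂ with ≤-total (d u w₁) (d u w₂)
    ... | inj₁ ≤₁₂ = tied-beyond-tied tw₁ tw₂ (beyond-nested ℓu b₁ b₂ ≤₁₂)
    ... | inj₂ ≤₂₁ = ≡-sym (tied-beyond-tied tw₂ tw₁ (beyond-nested ℓu b₂ b₁ ≤₂₁))

    first-edge : ∀ {w} → Tied w → ∃ λ c → adj G x c ≡ true × ℓ c ≡ 1 × Beyond c w
    first-edge {w} tw with ℓ w in ℓw
    ... | zero  = ⊥-elim (x≢y (trans (d≡0⇒≡ ℓw) (≡-sym (d≡0⇒≡ (≡-sym tw)))))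
    ... | suc k with d-firstStep ℓw
    ...   | c , e , dcw = c , e , ℓc≡1 , ≡-sym (cong₂ _+_ ℓc≡1 dcw)
      where
      ℓc≡1 : ℓ c ≡ 1
      ℓc≡1 = ≤-antisym (d-adj e) (n≢0⇒n>0 (λ ℓc≡0 → adj⇒≢ e (d≡0⇒≡ ℓc≡0)))

    -- Among three tied vertices two coincide: two of them lie beyond the same
    -- neighbour of x, because x has at most two neighbours.
    no-three-tied : ∀ {w₁ w₂ w₃} → Tied w₁ → Tied w₂ → Tied w₃ →
                    w₁ ≡ w₂ ⊎ w₁ ≡ w₃ ⊎ w₂ ≡ w₃
    no-three-tied t₁ t₂ t₃ with first-edge t₁ | first-edge t₂ | first-edge t₃
    ... | c₁ , e₁ , ℓc₁ , b₁ | c₂ , e₂ , ℓc₂ , b₂ | c₃ , e₃ , ℓc₃ , b₃ with deg2 x c₁ c₂ c₃ e₁ e₂ e₃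
    ... | inj₁ refl        = inj₁ (tied-beyond-same ℓc₁ b₁ b₂ t₁ t₂)
    ... | inj₂ (inj₁ refl) = inj₂ (inj₁ (tied-beyond-same ℓc₁ b₁ b₃ t₁ t₃))
    ... | inj₂ (inj₂ refl) = inj₂ (inj₂ (tied-beyond-same ℓc₂ b₂ b₃ t₂ t₃))

  equidistant≤2 : ∀ {x y} → x ≢ y → ∣ equidistant x y ∣ ≤ 2
  equidistant≤2 {x} {y} x≢y with ∣ equidistant x y ∣ ≤? 2
  ... | yes small = small
  ... | no large with threeMembers (equidistant x y) (≰⇒> large)
  ...   | a , b , c , (a∈ , b∈ , c∈) , (a≢b , a≢c , b≢c) =
    ⊥-elim ([ a≢b , [ a≢c , b≢c ]′ ]′ (no-three-tied (tied a∈) (tied b∈) (tied c∈)))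
    where open Levels x y x≢y renaming (equidistant⇒tied to tied)

  -- Hence every m-subset with m ≥ 3 resolves: it cannot fit inside any E(x,y).
  allSubsetsResolve : ∀ {m} → 3 ≤ m → AllKSubsetsResolve G m
  allSubsetsResolve {m} 3≤m S ∣S∣ x y x≢y
    with any? (λ w → (w ∈? S) ×-dec ¬? (w ∈? equidistant x y))
  ... | yes (w , w∈S , w∉E) = w , w∈S , ≢⇒resolves (λ e → w∉E (∈equidistant⁺ e))
  ... | no none = ⊥-elim (<-irrefl refl (begin
    3                      ≤⟨ 3≤m ⟩
    m                      ≡⟨ ≡-sym ∣S∣ ⟩
    ∣ S ∣                  ≤⟨ p⊆q⇒∣p∣≤∣q∣ S⊆E ⟩
    ∣ equidistant x y ∣    ≤⟨ equidistant≤2 x≢y ⟩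
    2                      ∎))
    where
    open ≤-Reasoning
    S⊆E : S ⊆ equidistant x y
    S⊆E {w} w∈S = decidable-stable (w ∈? equidistant x y) (λ w∉E → none (w , w∈S , w∉E))

order-bound : ∀ {m} → 3 ≤ m → ∀ G → Connected G → ResNumberIs G (suc m) → n G ≤ 6 * m
order-bound {m} 3≤m G conn (allRes , smaller) with n G ≤? 6 * m
... | yes bounded  = bounded
... | no unbounded =
  ⊥-elim (smaller m (n<1+n m) (DegreeTwo.allSubsetsResolve G conn maxDegreeTwo 3≤m))
  where
  -- As n G > 6m, no vertex has three distinct neighbours (degree-three-bound).
  maxDegreeTwo : MaxDegreeTwo G
  maxDegreeTwo z p q r ep eq er with p ≟ᶠ q | p ≟ᶠ r | q ≟ᶠ r
  ... | yes p≡q | _       | _       = inj₁ p≡q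
  ... | no _    | yes p≡r | _       = inj₂ (inj₁ p≡r)
  ... | no _    | no _    | yes q≡r = inj₂ (inj₂ q≡r)
  ... | no p≢q  | no p≢r  | no q≢r  =
    ⊥-elim (unbounded (DegreeThree.degree-three-bound G conn allRes ep eq er p≢q p≢r q≢r))

module Functions {B : Set} (R : B → B → Set) (bs : List B) (complete : ∀ b → Any (R b) bs) where

  functions : ∀ k → List (Vector.Vector B k)
  functions zero    = Vector.[] ∷ˡ []ˡ
  functions (suc k) = cartesianProductWith Vector._∷_ bs (functions k)

  functions-complete : ∀ k (f : Fin k → B) → Any (λ g → ∀ i → R (f i) (g i)) (functions k)
  functions-complete zero    f = here (λ ())
  functions-complete (suc k) f = Any.cartesianProductWith⁺ Vector._∷_ extend
    (complete (f zero)) (functions-complete k (λ i → f (suc i)))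
    where
    extend : ∀ {b g} → R (f zero) b → (∀ i → R (f (suc i)) (g i)) → ∀ i → R (f i) ((b Vector.∷ g) i)
    extend r rs zero    = r
    extend r rs (suc i) = rs i

booleans : List Bool
booleans = true ∷ˡ false ∷ˡ []ˡ

booleans-complete : ∀ b → Any (b ≡_) booleans
booleans-complete true  = here refl
booleans-complete false = there (here refl)

module Rows = Functions _≡_ booleans booleans-complete

module Matrices (k : ℕ) =
  Functions (λ r r′ → ∀ j → r j ≡ r′ j) (Rows.functions k) (Rows.functions-complete k)

matrices : ∀ k → List (Fin k → Fin k → Bool)
matrices k = Matrices.functions k k

matrices-complete : ∀ k (g : Fin k → Fin k → Bool) →
                    Any (λ h → ∀ i j → g i j ≡ h i j) (matrices k)
matrices-complete k = Matrices.functions-complete k k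

distinct : ∀ {k} → Fin k → Fin k → Bool
distinct u v = not (does (u ≟ᶠ v))

distinct-sym : ∀ {k} (u v : Fin k) → distinct u v ≡ distinct v u
distinct-sym u v with u ≟ᶠ v | v ≟ᶠ u
... | yes _    | yes _    = refl
... | no _     | no _     = refl
... | yes refl | no v≢u   = ⊥-elim (v≢u refl)
... | no u≢v   | yes refl = ⊥-elim (u≢v refl)

distinct-refl : ∀ {k} (u : Fin k) → distinct u u ≡ false
distinct-refl u with u ≟ᶠ u
... | yes _  = refl
... | no u≢u = ⊥-elim (u≢u refl)

fromMatrix : ∀ k → (Fin k → Fin k → Bool) → Graph
fromMatrix k g = record
  { n      = k
  ; adj    = λ u v → distinct u v ∧ (g u v ∧ g v u)
  ; sym    = λ u v → cong₂ _∧_ (distinct-sym u v) (∧-comm (g u v) (g v u))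
  ; irrefl = λ u → cong (_∧ (g u u ∧ g u u)) (distinct-refl u)
  }

fromMatrix-≅ : ∀ G (g : V G → V G → Bool) → (∀ u v → adj G u v ≡ g u v) → G ≅ fromMatrix (n G) g
fromMatrix-≅ G g agree = ↔-refl , same-adj
  where
  same-adj : ∀ u v → distinct u v ∧ (g u v ∧ g v u) ≡ adj G u v
  same-adj u v with u ≟ᶠ v
  ... | yes refl = ≡-sym (irrefl G u)
  ... | no _     = begin
    g u v ∧ g v u         ≡⟨ cong₂ _∧_ (≡-sym (agree u v)) (trans (≡-sym (agree v u)) (sym G v u)) ⟩
    adj G u v ∧ adj G u v ≡⟨ ∧-idem (adj G u v) ⟩
    adj G u v             ∎
    where open ≡-Reasoning

graphsOn : ℕ → List Graph
graphsOn k = map (fromMatrix k) (matrices k)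

graphsOn-complete : ∀ G → Any (G ≅_) (graphsOn (n G))
graphsOn-complete G =
  Any.map⁺ (Any.map (λ {g} → fromMatrix-≅ G g) (matrices-complete (n G) (adj G)))

graphsUpTo : ℕ → List Graph
graphsUpTo N = concat (applyUpTo graphsOn (suc N))

graphsUpTo-complete : ∀ {N} G → n G ≤ N → Any (G ≅_) (graphsUpTo N)
graphsUpTo-complete G n≤N = Any.concat⁺ (Any.applyUpTo⁺ graphsOn (graphsOn-complete G) (s≤s n≤N))

theorem3p7 : ∀ (a : ℕ) → 4 ≤ a →
    ∃ λ (L : List Graph) →
      ∀ (G : Graph) → Connected G → ResNumberIs G a → Any (λ H → G ≅ H) L
theorem3p7 (suc m) (s≤s 3≤m) =
  graphsUpTo (6 * m) , λ G conn res → graphsUpTo-complete G (order-bound 3≤m G conn res)
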